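{- Let $L$ be a lattice isomorphic to a sublattice of a free lattice, and assume that $L$ belongs to the variety $\mathcal{N}$ generated by $N_5$. Let $a, b_1, b_2, b_3, b_4, b_5 \in L$ be such that $a \parallel b_i$ for all $1 \leq i \leq 5$, $b_i < b_{i+1}$ for all $1 \leq i \leq 4$, and $a \vee b_i < a \vee b_{i+1}$ for all $1 \leq i \leq 4$. If $(a \vee b_4) \wedge b_5 \neq b_4$, then $(a \vee b_3) \wedge b_5$ is covered by $a \vee b_3$ in $L$.
   Context: $N_5$ is the five-element lattice $\{0, x, y, z, 1\}$ with $0 < y < z < 1$, $0 < x < 1$, $x \parallel y$, $x \parallel z$; $\mathcal{N}$ is the lattice variety it generates. $u \parallel v$ means $u,v$ are incomparable. For $u < v$ in $L$, $u$ is covered by $v$ in $L$ if there is no $w \in L$ with $u < w < v$. -}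

module Defs where

open import Level using (Level; _⊔_)
open import Data.Nat using (ℕ)
open import Data.Product using (_×_; Σ)
open import Relation.Nullary using (¬_)
open import Relation.Binary.PropositionalEquality using (_≡_)
open import Algebra.Lattice.Bundles using (Lattice)

data Term {a : Level} (X : Set a) : Set a where
  var  : X → Term X
  _∨ₜ_ : Term X → Term X → Term X
  _∧ₜ_ : Term X → Term X → Term X

-- The free lattice FL(X): terms modulo the congruence generated by the
-- lattice axioms (the standard term construction of the free lattice).

infix 4 _≈F_
data _≈F_ {a : Level} {X : Set a} : Term X → Term X → Set a where
  F-refl   : ∀ {s} → s ≈F s
  F-sym    : ∀ {s t} → s ≈F t → t ≈F s
  F-trans  : ∀ {s t u} → s ≈F t → t ≈F u → s ≈F u
  F-∨-cong : ∀ {s s' t t'} → s ≈F s' → t ≈F t' → (s ∨ₜ t) ≈F (s' ∨ₜ t')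
  F-∧-cong : ∀ {s s' t t'} → s ≈F s' → t ≈F t' → (s ∧ₜ t) ≈F (s' ∧ₜ t')
  F-∨-comm : ∀ {s t} → (s ∨ₜ t) ≈F (t ∨ₜ s)
  F-∧-comm : ∀ {s t} → (s ∧ₜ t) ≈F (t ∧ₜ s)
  F-∨-assoc : ∀ {s t u} → ((s ∨ₜ t) ∨ₜ u) ≈F (s ∨ₜ (t ∨ₜ u))
  F-∧-assoc : ∀ {s t u} → ((s ∧ₜ t) ∧ₜ u) ≈F (s ∧ₜ (t ∧ₜ u))
  F-∨-absorbs-∧ : ∀ {s t} → (s ∨ₜ (s ∧ₜ t)) ≈F s
  F-∧-absorbs-∨ : ∀ {s t} → (s ∧ₜ (s ∨ₜ t)) ≈F s

record EmbedsInFreeLattice {c ℓ a : Level} (L : Lattice c ℓ) (X : Set a)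
       : Set (c ⊔ ℓ ⊔ a) where
  open Lattice L
  field
    f         : Carrier → Term X
    f-cong    : ∀ {x y} → x ≈ y → f x ≈F f y
    f-∨       : ∀ x y → f (x ∨ y) ≈F (f x ∨ₜ f y)
    f-∧       : ∀ x y → f (x ∧ y) ≈F (f x ∧ₜ f y)
    f-injective : ∀ {x y} → f x ≈F f y → x ≈ y

-- The lattice N5 = {0, x, y, z, 1}, 0 < y < z < 1, 0 < x < 1, x ∥ y, x ∥ z

data N5 : Set where
  n0 nx ny nz n1 : N5

join : N5 → N5 → N5
join n0 b  = b
join n1 b  = n1
join nx n0 = nx
join nx nx = nx
join nx ny = n1
join nx nz = n1
join nx n1 = n1
join ny n0 = ny
join ny nx = n1
join ny ny = ny
join ny nz = nz
join ny n1 = n1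
join nz n0 = nz
join nz nx = n1
join nz ny = nz
join nz nz = nz
join nz n1 = n1

meet : N5 → N5 → N5
meet n0 b  = n0
meet n1 b  = b
meet nx n0 = n0
meet nx nx = nx
meet nx ny = n0
meet nx nz = n0
meet nx n1 = nx
meet ny n0 = n0
meet ny nx = n0
meet ny ny = ny
meet ny nz = ny
meet ny n1 = ny
meet nz n0 = n0
meet nz nx = n0
meet nz ny = ny
meet nz nz = nz
meet nz n1 = nz

evalN5 : (ℕ → N5) → Term ℕ → N5
evalN5 ρ (var i)  = ρ i
evalN5 ρ (s ∨ₜ t) = join (evalN5 ρ s) (evalN5 ρ t)
evalN5 ρ (s ∧ₜ t) = meet (evalN5 ρ s) (evalN5 ρ t)

module _ {c ℓ : Level} (L : Lattice c ℓ) where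
  open Lattice L

  eval : (ℕ → Carrier) → Term ℕ → Carrier
  eval ρ (var i)  = ρ i
  eval ρ (s ∨ₜ t) = eval ρ s ∨ eval ρ t
  eval ρ (s ∧ₜ t) = eval ρ s ∧ eval ρ t

  -- L belongs to the variety 𝒩 generated by N5, i.e. (Birkhoff) L
  -- satisfies every lattice identity that holds in N5.
  InVarietyN5 : Set (c ⊔ ℓ)
  InVarietyN5 = ∀ (s t : Term ℕ) →
    (∀ (ρ : ℕ → N5) → evalN5 ρ s ≡ evalN5 ρ t) →
    ∀ (ρ : ℕ → Carrier) → eval ρ s ≈ eval ρ t

  _≤L_ : Carrier → Carrier → Set ℓ
  u ≤L v = (u ∧ v) ≈ u

  _<L_ : Carrier → Carrier → Set ℓ
  u <L v = u ≤L v × ¬ (u ≈ v)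

  _∥L_ : Carrier → Carrier → Set ℓ
  u ∥L v = ¬ (u ≤L v) × ¬ (v ≤L u)

  CoveredBy : Carrier → Carrier → Set (c ⊔ ℓ)
  CoveredBy u v = u <L v × (∀ w → ¬ (u <L w × w <L v))

-- Suppose (a ∨ b₃) ∧ b₅ < w < a ∨ b₃. Three inequalities, valid in N5 under order
-- hypotheses and hence in every lattice of 𝒩, have the shape p ∧ q ≤ r ∨ s, so Whitman's
-- condition (W) applies to them; (W) holds in free lattices, hence in their sublattices.
-- For the first, three alternatives of (W) contradict the hypotheses and the fourth gives
-- a ∧ w ≤ b₅. Given that, all four alternatives for the second are contradictory, the
-- first of them because the third inequality then yields a ≤ b₅.
module Submission where

open import Defs
open import Level using (Level; _⊔_)
open import Relation.Nullary using (¬_)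
open import Algebra.Lattice.Bundles using (Lattice)

open import Algebra.Lattice.Properties.Lattice using (∨-∧-orderTheoreticLattice)
import Relation.Binary.Lattice.Bundles as Order
import Relation.Binary.Lattice.Properties.JoinSemilattice as JoinSemilatticeProperties
import Relation.Binary.Properties.Poset as PosetProperties
import Relation.Binary.Reasoning.PartialOrder as ≤-Reasoning
import Relation.Binary.Reasoning.Setoid as ≈-Reasoning
open import Relation.Binary.Definitions using (DecidableEquality)
open import Relation.Binary.PropositionalEquality using (_≡_; refl; cong; cong₂)
import Relation.Binary.PropositionalEquality as ≡
open import Relation.Nullary.Decidable using (Dec; map′; _×-dec_; True; toWitness)
open import Relation.Nullary.Negation using (contradiction)
open import Data.Product using (_×_; _,_; proj₁; ∃-syntax)
open import Data.Sum using (_⊎_; inj₁; inj₂)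
import Data.Sum as Sum
open import Data.Nat using (ℕ; zero; suc; s≤s)
import Data.Nat as Nat
open import Data.List using (List; []; _∷_; [_]; _++_; cartesianProductWith)
open import Data.List.Membership.Propositional using (_∈_)
open import Data.List.Membership.Propositional.Properties using (∈-cartesianProductWith⁺)
open import Data.List.Relation.Unary.All using (All; []; _∷_; all?; lookup)
open import Data.List.Relation.Unary.All.Properties using (++⁻ˡ; ++⁻ʳ)
open import Data.List.Relation.Unary.Any using (here; there)
open import Function using (_∘_; const; case_of_)

module LatticeOrder {c ℓ : Level} (L : Lattice c ℓ) where
  open Lattice L using (isEquivalence)

  private module Std = Order.Lattice (∨-∧-orderTheoreticLattice L)

  -- _≤L_ (u ∧ v ≈ u) is the library's order u ≈ u ∧ v with ≈ reversed.
  orderTheoreticLattice : Order.Lattice c ℓ ℓ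
  orderTheoreticLattice = record
    { _≤_ = _≤L_ L
    ; isLattice = record
      { isPartialOrder = record
        { isPreorder = record
          { isEquivalence = isEquivalence
          ; reflexive = λ x≈y → Std.Eq.sym (Std.reflexive x≈y)
          ; trans = λ x≤y y≤z → Std.Eq.sym (Std.trans (Std.Eq.sym x≤y) (Std.Eq.sym y≤z))
          }
        ; antisym = λ x≤y y≤x → Std.antisym (Std.Eq.sym x≤y) (Std.Eq.sym y≤x)
        }
      ; supremum = λ x y →
          Std.Eq.sym (Std.x≤x∨y x y) , Std.Eq.sym (Std.y≤x∨y x y) ,
          λ z x≤z y≤z → Std.Eq.sym (Std.∨-least (Std.Eq.sym x≤z) (Std.Eq.sym y≤z))
      ; infimum = λ x y →
          Std.Eq.sym (Std.x∧y≤x x y) , Std.Eq.sym (Std.x∧y≤y x y) ,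
          λ z z≤x z≤y → Std.Eq.sym (Std.∧-greatest (Std.Eq.sym z≤x) (Std.Eq.sym z≤y))
      }
    }

  open Order.Lattice orderTheoreticLattice public
    using (_≤_; _∨_; _∧_; poset; joinSemilattice;
           x≤x∨y; y≤x∨y; ∨-least; x∧y≤x; x∧y≤y; ∧-greatest)
    renaming (refl to ≤-refl; reflexive to ≤-reflexive; trans to ≤-trans)
  open JoinSemilatticeProperties joinSemilattice public using (∨-monotonic; x≤y⇒x∨y≈y)
  open PosetProperties poset public using (_<_; ≤∧≉⇒<)

Whitman : ∀ {c ℓ} → Lattice c ℓ → Set (c ⊔ ℓ)
Whitman L = ∀ {a b u v} → a ∧ b ≤ u ∨ v →
  a ≤ u ∨ v ⊎ b ≤ u ∨ v ⊎ a ∧ b ≤ u ⊎ a ∧ b ≤ v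
  where open LatticeOrder L

module FreeLattice {x : Level} (X : Set x) where

  FL : Lattice x x
  FL = record
    { Carrier = Term X ; _≈_ = _≈F_ ; _∨_ = _∨ₜ_ ; _∧_ = _∧ₜ_
    ; isLattice = record
      { isEquivalence = record { refl = F-refl ; sym = F-sym ; trans = F-trans }
      ; ∨-comm = λ _ _ → F-∨-comm ; ∨-assoc = λ _ _ _ → F-∨-assoc ; ∨-cong = F-∨-cong
      ; ∧-comm = λ _ _ → F-∧-comm ; ∧-assoc = λ _ _ _ → F-∧-assoc ; ∧-cong = F-∧-cong
      ; absorptive = (λ _ _ → F-∨-absorbs-∧) , (λ _ _ → F-∧-absorbs-∨)
      }
    }

  -- Whitman's cut-free sequent calculus for the order of FL(X): since cut
  -- (⊑-trans) is admissible, the last rule of a derivation of s ∧ t ⊑ u ∨ v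
  -- yields Whitman's condition.
  infix 4 _⊑_
  data _⊑_ : Term X → Term X → Set x where
    var⊑var : ∀ {i} → var i ⊑ var i
    ∨⊑      : ∀ {s t u} → s ⊑ u → t ⊑ u → s ∨ₜ t ⊑ u
    ⊑∧      : ∀ {s t u} → s ⊑ t → s ⊑ u → s ⊑ t ∧ₜ u
    ⊑∨ˡ     : ∀ {s t u} → s ⊑ t → s ⊑ t ∨ₜ u
    ⊑∨ʳ     : ∀ {s t u} → s ⊑ u → s ⊑ t ∨ₜ u
    ∧ˡ⊑     : ∀ {s t u} → s ⊑ u → s ∧ₜ t ⊑ u
    ∧ʳ⊑     : ∀ {s t u} → t ⊑ u → s ∧ₜ t ⊑ u

  ⊑-refl : ∀ {s} → s ⊑ s
  ⊑-refl {var i}  = var⊑var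
  ⊑-refl {s ∨ₜ t} = ∨⊑ (⊑∨ˡ ⊑-refl) (⊑∨ʳ ⊑-refl)
  ⊑-refl {s ∧ₜ t} = ⊑∧ (∧ˡ⊑ ⊑-refl) (∧ʳ⊑ ⊑-refl)

  ⊑-trans : ∀ {s t u} → s ⊑ t → t ⊑ u → s ⊑ u
  ⊑-trans (∨⊑ p q) r        = ∨⊑ (⊑-trans p r) (⊑-trans q r)
  ⊑-trans (∧ˡ⊑ p) r         = ∧ˡ⊑ (⊑-trans p r)
  ⊑-trans (∧ʳ⊑ p) r         = ∧ʳ⊑ (⊑-trans p r)
  ⊑-trans p (⊑∧ q r)        = ⊑∧ (⊑-trans p q) (⊑-trans p r)
  ⊑-trans p (⊑∨ˡ q)         = ⊑∨ˡ (⊑-trans p q)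
  ⊑-trans p (⊑∨ʳ q)         = ⊑∨ʳ (⊑-trans p q)
  ⊑-trans var⊑var q         = q
  ⊑-trans (⊑∧ p _) (∧ˡ⊑ q)  = ⊑-trans p q
  ⊑-trans (⊑∧ _ p) (∧ʳ⊑ q)  = ⊑-trans p q
  ⊑-trans (⊑∨ˡ p) (∨⊑ q _)  = ⊑-trans p q
  ⊑-trans (⊑∨ʳ p) (∨⊑ _ q)  = ⊑-trans p q

  ≈F⇒⊑×⊒ : ∀ {s t} → s ≈F t → s ⊑ t × t ⊑ s
  ≈F⇒⊑×⊒ F-refl = ⊑-refl , ⊑-refl
  ≈F⇒⊑×⊒ (F-sym p) with ≈F⇒⊑×⊒ p
  ... | s⊑t , t⊑s = t⊑s , s⊑t
  ≈F⇒⊑×⊒ (F-trans p q) with ≈F⇒⊑×⊒ p | ≈F⇒⊑×⊒ q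
  ... | s⊑t , t⊑s | t⊑u , u⊑t = ⊑-trans s⊑t t⊑u , ⊑-trans u⊑t t⊑s
  ≈F⇒⊑×⊒ (F-∨-cong p q) with ≈F⇒⊑×⊒ p | ≈F⇒⊑×⊒ q
  ... | s⊑s′ , s′⊑s | t⊑t′ , t′⊑t =
    ∨⊑ (⊑∨ˡ s⊑s′) (⊑∨ʳ t⊑t′) , ∨⊑ (⊑∨ˡ s′⊑s) (⊑∨ʳ t′⊑t)
  ≈F⇒⊑×⊒ (F-∧-cong p q) with ≈F⇒⊑×⊒ p | ≈F⇒⊑×⊒ q
  ... | s⊑s′ , s′⊑s | t⊑t′ , t′⊑t =
    ⊑∧ (∧ˡ⊑ s⊑s′) (∧ʳ⊑ t⊑t′) , ⊑∧ (∧ˡ⊑ s′⊑s) (∧ʳ⊑ t′⊑t)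
  ≈F⇒⊑×⊒ F-∨-comm = ∨⊑ (⊑∨ʳ ⊑-refl) (⊑∨ˡ ⊑-refl) , ∨⊑ (⊑∨ʳ ⊑-refl) (⊑∨ˡ ⊑-refl)
  ≈F⇒⊑×⊒ F-∧-comm = ⊑∧ (∧ʳ⊑ ⊑-refl) (∧ˡ⊑ ⊑-refl) , ⊑∧ (∧ʳ⊑ ⊑-refl) (∧ˡ⊑ ⊑-refl)
  ≈F⇒⊑×⊒ F-∨-assoc =
    ∨⊑ (∨⊑ (⊑∨ˡ ⊑-refl) (⊑∨ʳ (⊑∨ˡ ⊑-refl))) (⊑∨ʳ (⊑∨ʳ ⊑-refl)) ,
    ∨⊑ (⊑∨ˡ (⊑∨ˡ ⊑-refl)) (∨⊑ (⊑∨ˡ (⊑∨ʳ ⊑-refl)) (⊑∨ʳ ⊑-refl))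
  ≈F⇒⊑×⊒ F-∧-assoc =
    ⊑∧ (∧ˡ⊑ (∧ˡ⊑ ⊑-refl)) (⊑∧ (∧ˡ⊑ (∧ʳ⊑ ⊑-refl)) (∧ʳ⊑ ⊑-refl)) ,
    ⊑∧ (⊑∧ (∧ˡ⊑ ⊑-refl) (∧ʳ⊑ (∧ˡ⊑ ⊑-refl))) (∧ʳ⊑ (∧ʳ⊑ ⊑-refl))
  ≈F⇒⊑×⊒ F-∨-absorbs-∧ = ∨⊑ ⊑-refl (∧ˡ⊑ ⊑-refl) , ⊑∨ˡ ⊑-refl
  ≈F⇒⊑×⊒ F-∧-absorbs-∨ = ∧ˡ⊑ ⊑-refl , ⊑∧ ⊑-refl (⊑∨ˡ ⊑-refl)

  ⊑-whitman : ∀ {s t u v} → s ∧ₜ t ⊑ u ∨ₜ v →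
    s ⊑ u ∨ₜ v ⊎ t ⊑ u ∨ₜ v ⊎ s ∧ₜ t ⊑ u ⊎ s ∧ₜ t ⊑ v
  ⊑-whitman (∧ˡ⊑ p) = inj₁ p
  ⊑-whitman (∧ʳ⊑ p) = inj₂ (inj₁ p)
  ⊑-whitman (⊑∨ˡ p) = inj₂ (inj₂ (inj₁ p))
  ⊑-whitman (⊑∨ʳ p) = inj₂ (inj₂ (inj₂ p))

  ≈F⇒⊑ : ∀ {s t} → s ≈F t → s ⊑ t
  ≈F⇒⊑ p = proj₁ (≈F⇒⊑×⊒ p)

  open LatticeOrder FL renaming (_≤_ to _≤F_)

  ⊑⇒≤F : ∀ {s t} → s ⊑ t → s ≤F t
  ⊑⇒≤F var⊑var  = ≤-refl
  ⊑⇒≤F (∨⊑ p q) = ∨-least (⊑⇒≤F p) (⊑⇒≤F q)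
  ⊑⇒≤F (⊑∧ p q) = ∧-greatest (⊑⇒≤F p) (⊑⇒≤F q)
  ⊑⇒≤F (⊑∨ˡ p)  = ≤-trans (⊑⇒≤F p) (x≤x∨y _ _)
  ⊑⇒≤F (⊑∨ʳ p)  = ≤-trans (⊑⇒≤F p) (y≤x∨y _ _)
  ⊑⇒≤F (∧ˡ⊑ p)  = ≤-trans (x∧y≤x _ _) (⊑⇒≤F p)
  ⊑⇒≤F (∧ʳ⊑ p)  = ≤-trans (x∧y≤y _ _) (⊑⇒≤F p)

module _ {c ℓ x : Level} (L : Lattice c ℓ) (X : Set x) (E : EmbedsInFreeLattice L X) where
  open LatticeOrder L
  open FreeLattice X
  open EmbedsInFreeLattice E

  f-monotone : ∀ {a b} → a ≤ b → f a ⊑ f b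
  f-monotone {a} {b} a∧b≈a = ⊑-trans (≈F⇒⊑ (F-trans (F-sym (f-cong a∧b≈a)) (f-∧ a b))) (∧ʳ⊑ ⊑-refl)

  f-reflects-≤ : ∀ {a b} → f a ⊑ f b → a ≤ b
  f-reflects-≤ {a} {b} fa⊑fb = f-injective (F-trans (f-∧ a b) (⊑⇒≤F fa⊑fb))

  embedding⇒whitman : Whitman L
  embedding⇒whitman {a} {b} {u} {v} a∧b≤u∨v =
    Sum.map reflect-∨ (Sum.map reflect-∨ (Sum.map reflect-∧ reflect-∧)) (⊑-whitman fa∧fb⊑fu∨fv)
    where
    fa∧fb⊑fu∨fv : f a ∧ₜ f b ⊑ f u ∨ₜ f v
    fa∧fb⊑fu∨fv = ⊑-trans (≈F⇒⊑ (F-sym (f-∧ a b))) (⊑-trans (f-monotone a∧b≤u∨v) (≈F⇒⊑ (f-∨ u v)))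
    reflect-∨ : ∀ {s} → f s ⊑ f u ∨ₜ f v → s ≤ u ∨ v
    reflect-∨ p = f-reflects-≤ (⊑-trans p (≈F⇒⊑ (F-sym (f-∨ u v))))
    reflect-∧ : ∀ {t} → f a ∧ₜ f b ⊑ f t → a ∧ b ≤ t
    reflect-∧ p = f-reflects-≤ (⊑-trans (≈F⇒⊑ (f-∧ a b)) p)

module N5Identities where
  open Nat using (_<_; _<?_)

  elements : List N5
  elements = n0 ∷ nx ∷ ny ∷ nz ∷ n1 ∷ []

  ∈-elements : ∀ x → x ∈ elements
  ∈-elements n0 = here refl
  ∈-elements nx = there (here refl)
  ∈-elements ny = there (there (here refl))
  ∈-elements nz = there (there (there (here refl)))
  ∈-elements n1 = there (there (there (there (here refl))))

  private
    index : N5 → ℕ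
    index n0 = 0
    index nx = 1
    index ny = 2
    index nz = 3
    index n1 = 4

    decode : ℕ → N5
    decode 0 = n0
    decode 1 = nx
    decode 2 = ny
    decode 3 = nz
    decode _ = n1

    decode-index : ∀ x → decode (index x) ≡ x
    decode-index n0 = refl
    decode-index nx = refl
    decode-index ny = refl
    decode-index nz = refl
    decode-index n1 = refl

    index-injective : ∀ {x y} → index x ≡ index y → x ≡ y
    index-injective {x} {y} ix≡iy =
      ≡.trans (≡.sym (decode-index x)) (≡.trans (cong decode ix≡iy) (decode-index y))

  _≟_ : DecidableEquality N5
  x ≟ y = map′ index-injective (cong index) (index x Nat.≟ index y)

  _◂_ : N5 → (ℕ → N5) → ℕ → N5
  (x ◂ ρ) zero    = x
  (x ◂ ρ) (suc i) = ρ i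

  valuations : ℕ → List (ℕ → N5)
  valuations zero    = [ const n0 ]
  valuations (suc n) = cartesianProductWith _◂_ elements (valuations n)

  valuations-complete : ∀ n (ρ : ℕ → N5) →
    ∃[ ρ′ ] ρ′ ∈ valuations n × (∀ {i} → i < n → ρ′ i ≡ ρ i)
  valuations-complete zero    ρ = const n0 , here refl , λ ()
  valuations-complete (suc n) ρ with valuations-complete n (ρ ∘ suc)
  ... | ρ′ , ρ′∈ , ρ′≗ρ∘suc =
    ρ zero ◂ ρ′ , ∈-cartesianProductWith⁺ _◂_ (∈-elements (ρ zero)) ρ′∈ , agree
    where
    agree : ∀ {i} → i < suc n → (ρ zero ◂ ρ′) i ≡ ρ i
    agree {zero}  _         = refl
    agree {suc i} (s≤s i<n) = ρ′≗ρ∘suc i<n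

  variables : Term ℕ → List ℕ
  variables (var i)  = [ i ]
  variables (s ∨ₜ t) = variables s ++ variables t
  variables (s ∧ₜ t) = variables s ++ variables t

  evalN5-local : ∀ {n ρ ρ′} → (∀ {i} → i < n → ρ i ≡ ρ′ i) →
    ∀ s → All (_< n) (variables s) → evalN5 ρ s ≡ evalN5 ρ′ s
  evalN5-local ρ≗ρ′ (var i)  (i<n ∷ []) = ρ≗ρ′ i<n
  evalN5-local ρ≗ρ′ (s ∨ₜ t) vars<n =
    cong₂ join (evalN5-local ρ≗ρ′ s (++⁻ˡ _ vars<n)) (evalN5-local ρ≗ρ′ t (++⁻ʳ _ vars<n))
  evalN5-local ρ≗ρ′ (s ∧ₜ t) vars<n =
    cong₂ meet (evalN5-local ρ≗ρ′ s (++⁻ˡ _ vars<n)) (evalN5-local ρ≗ρ′ t (++⁻ʳ _ vars<n))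

  Checked : ℕ → Term ℕ → Term ℕ → Set
  Checked n s t =
    All (_< n) (variables (s ∧ₜ t)) × All (λ ρ → evalN5 ρ s ≡ evalN5 ρ t) (valuations n)

  checked? : ∀ n s t → Dec (Checked n s t)
  checked? n s t = all? (_<? n) _ ×-dec all? (λ ρ → evalN5 ρ s ≟ evalN5 ρ t) _

  checked⇒holds : ∀ n s t → Checked n s t → ∀ ρ → evalN5 ρ s ≡ evalN5 ρ t
  checked⇒holds n s t (vars<n , holds) ρ with valuations-complete n ρ
  ... | ρ′ , ρ′∈ , ρ′≗ρ = begin
    evalN5 ρ s   ≡⟨ evalN5-local ρ′≗ρ s (++⁻ˡ _ vars<n) ⟨
    evalN5 ρ′ s  ≡⟨ lookup holds ρ′∈ ⟩
    evalN5 ρ′ t  ≡⟨ evalN5-local ρ′≗ρ t (++⁻ʳ _ vars<n) ⟩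
    evalN5 ρ t   ∎
    where open ≡.≡-Reasoning

substitute : (ℕ → Term ℕ) → Term ℕ → Term ℕ
substitute σ (var i)  = σ i
substitute σ (s ∨ₜ t) = substitute σ s ∨ₜ substitute σ t
substitute σ (s ∧ₜ t) = substitute σ s ∧ₜ substitute σ t

module Evaluation {c ℓ : Level} (L : Lattice c ℓ) where
  open Lattice L using (_≈_; _∨_; _∧_; ∨-cong; ∧-cong; setoid)
  open N5Identities using (checked?; checked⇒holds)

  eval-substitute : ∀ ρ σ t → eval L ρ (substitute σ t) ≡ eval L (eval L ρ ∘ σ) t
  eval-substitute ρ σ (var i)  = refl
  eval-substitute ρ σ (s ∨ₜ t) = cong₂ _∨_ (eval-substitute ρ σ s) (eval-substitute ρ σ t)
  eval-substitute ρ σ (s ∧ₜ t) = cong₂ _∧_ (eval-substitute ρ σ s) (eval-substitute ρ σ t)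

  eval-cong : ∀ {ρ ρ′} → (∀ i → ρ i ≈ ρ′ i) → ∀ t → eval L ρ t ≈ eval L ρ′ t
  eval-cong ρ≈ρ′ (var i)  = ρ≈ρ′ i
  eval-cong ρ≈ρ′ (s ∨ₜ t) = ∨-cong (eval-cong ρ≈ρ′ s) (eval-cong ρ≈ρ′ t)
  eval-cong ρ≈ρ′ (s ∧ₜ t) = ∧-cong (eval-cong ρ≈ρ′ s) (eval-cong ρ≈ρ′ t)

  -- A hypothesis x ≤ y is encoded by substituting x ∨ y for y (or x ∧ y for x):
  -- σ fixes ρ exactly when the hypotheses hold at ρ, so an identity of N5 between
  -- the substituted terms yields a quasi-identity of 𝒩.
  N5-law-at-fixed-point : InVarietyN5 L → ∀ n σ s t →
    {True (checked? n (substitute σ s) (substitute σ t))} →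
    ∀ ρ → (∀ i → eval L ρ (σ i) ≈ ρ i) → eval L ρ s ≈ eval L ρ t
  N5-law-at-fixed-point V n σ s t {checked} ρ ρ-fixed = begin
    eval L ρ s                 ≈⟨ eval-cong ρ-fixed s ⟨
    eval L (eval L ρ ∘ σ) s    ≡⟨ eval-substitute ρ σ s ⟨
    eval L ρ (substitute σ s)  ≈⟨ V (substitute σ s) (substitute σ t) N5⊨s[σ]≈t[σ] ρ ⟩
    eval L ρ (substitute σ t)  ≡⟨ eval-substitute ρ σ t ⟩
    eval L (eval L ρ ∘ σ) t    ≈⟨ eval-cong ρ-fixed t ⟩
    eval L ρ t                 ∎
    where
    open ≈-Reasoning setoid
    N5⊨s[σ]≈t[σ] : ∀ ρN → evalN5 ρN (substitute σ s) ≡ evalN5 ρN (substitute σ t)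
    N5⊨s[σ]≈t[σ] = checked⇒holds n (substitute σ s) (substitute σ t) (toWitness checked)

module 𝒩Inequalities {c ℓ : Level} (L : Lattice c ℓ) (V : InVarietyN5 L) where
  open Lattice L using (Carrier; _≈_; ∧-cong; ∨-cong) renaming (refl to ≈-refl)
  open LatticeOrder L
  open Evaluation L using (N5-law-at-fixed-point)

  x₀ x₁ x₂ x₃ x₄ : Term ℕ
  x₀ = var 0
  x₁ = var 1
  x₂ = var 2
  x₃ = var 3
  x₄ = var 4

  [a∨b]∧[a∧w∨c∧w]≤a∧w∨[a∨b]∧c : ∀ {a b c w} → b ≤ c →
    (a ∨ b) ∧ (a ∧ w ∨ c ∧ w) ≤ a ∧ w ∨ (a ∨ b) ∧ c
  [a∨b]∧[a∧w∨c∧w]≤a∧w∨[a∨b]∧c {a} {b} {c} {w} b≤c =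
    N5-law-at-fixed-point V 4 σ (lhs ∧ₜ rhs) lhs ρ ρ-fixed
    where
    lhs rhs : Term ℕ
    lhs = (x₀ ∨ₜ x₁) ∧ₜ ((x₀ ∧ₜ x₃) ∨ₜ (x₂ ∧ₜ x₃))
    rhs = (x₀ ∧ₜ x₃) ∨ₜ ((x₀ ∨ₜ x₁) ∧ₜ x₂)
    σ : ℕ → Term ℕ
    σ 2 = x₁ ∨ₜ x₂
    σ i = var i
    ρ : ℕ → Carrier
    ρ 0 = a
    ρ 1 = b
    ρ 2 = c
    ρ _ = w
    ρ-fixed : ∀ i → eval L ρ (σ i) ≈ ρ i
    ρ-fixed 0 = ≈-refl
    ρ-fixed 1 = ≈-refl
    ρ-fixed 2 = x≤y⇒x∨y≈y b≤c
    ρ-fixed (suc (suc (suc _))) = ≈-refl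

  [a∨b]∧[c∨w]≤w∨[a∨b]∧c : ∀ {a b c w} → b ≤ c → a ∧ w ≤ c →
    (a ∨ b) ∧ (c ∨ w) ≤ w ∨ (a ∨ b) ∧ c
  [a∨b]∧[c∨w]≤w∨[a∨b]∧c {a} {b} {c} {w} b≤c a∧w≤c =
    N5-law-at-fixed-point V 4 σ (lhs ∧ₜ rhs) lhs ρ ρ-fixed
    where
    lhs rhs : Term ℕ
    lhs = (x₀ ∨ₜ x₁) ∧ₜ (x₂ ∨ₜ x₃)
    rhs = x₃ ∨ₜ ((x₀ ∨ₜ x₁) ∧ₜ x₂)
    σ : ℕ → Term ℕ
    σ 2 = (x₁ ∨ₜ (x₀ ∧ₜ x₃)) ∨ₜ x₂
    σ i = var i
    ρ : ℕ → Carrier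
    ρ 0 = a
    ρ 1 = b
    ρ 2 = c
    ρ _ = w
    ρ-fixed : ∀ i → eval L ρ (σ i) ≈ ρ i
    ρ-fixed 0 = ≈-refl
    ρ-fixed 1 = ≈-refl
    ρ-fixed 2 = x≤y⇒x∨y≈y (∨-least b≤c a∧w≤c)
    ρ-fixed (suc (suc (suc _))) = ≈-refl

  [a∨d]≤w∨[a∨d]∧c⇒a≤c : ∀ {a b c d w} → (a ∨ b) ∧ c ≤ w → a ∧ w ≤ c →
    a ∨ d ≤ w ∨ (a ∨ d) ∧ c → a ≤ c
  [a∨d]≤w∨[a∨d]∧c⇒a≤c {a} {b} {c} {d} {w} [a∨b]∧c≤w a∧w≤c a∨d≤w∨[a∨d]∧c =
    N5-law-at-fixed-point V 5 σ (x₀ ∧ₜ x₂) x₀ ρ ρ-fixed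
    where
    W C : Term ℕ
    W = ((x₀ ∨ₜ x₁) ∧ₜ x₂) ∨ₜ x₄
    C = (x₀ ∧ₜ W) ∨ₜ x₂
    σ : ℕ → Term ℕ
    σ 0 = x₀ ∧ₜ (W ∨ₜ ((x₀ ∨ₜ x₃) ∧ₜ C))
    σ 2 = C
    σ 4 = W
    σ i = var i
    ρ : ℕ → Carrier
    ρ 0 = a
    ρ 1 = b
    ρ 2 = c
    ρ 3 = d
    ρ _ = w
    w′ c′ : Carrier
    w′ = (a ∨ b) ∧ c ∨ w
    c′ = a ∧ w′ ∨ c
    w′≈w : w′ ≈ w
    w′≈w = x≤y⇒x∨y≈y [a∨b]∧c≤w
    a∧w′≤a∧w : a ∧ w′ ≤ a ∧ w
    a∧w′≤a∧w = ∧-greatest (x∧y≤x a w′) (≤-trans (x∧y≤y a w′) (≤-reflexive w′≈w))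
    c′≈c : c′ ≈ c
    c′≈c = x≤y⇒x∨y≈y (≤-trans a∧w′≤a∧w a∧w≤c)
    a≤w′∨[a∨d]∧c′ : a ≤ w′ ∨ (a ∨ d) ∧ c′
    a≤w′∨[a∨d]∧c′ = begin
      a                   ≤⟨ x≤x∨y a d ⟩
      a ∨ d               ≤⟨ a∨d≤w∨[a∨d]∧c ⟩
      w ∨ (a ∨ d) ∧ c     ≈⟨ ∨-cong w′≈w (∧-cong ≈-refl c′≈c) ⟨
      w′ ∨ (a ∨ d) ∧ c′   ∎
      where open ≤-Reasoning poset
    ρ-fixed : ∀ i → eval L ρ (σ i) ≈ ρ i
    ρ-fixed 0 = a≤w′∨[a∨d]∧c′
    ρ-fixed 1 = ≈-refl
    ρ-fixed 2 = c′≈c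
    ρ-fixed 3 = ≈-refl
    ρ-fixed 4 = w′≈w
    ρ-fixed (suc (suc (suc (suc (suc _))))) = ≈-refl

module Covering {c ℓ : Level} (L : Lattice c ℓ) (V : InVarietyN5 L) (W : Whitman L) where
  open Lattice L using (_≈_)
  open LatticeOrder L
  open 𝒩Inequalities L V
  open ≤-Reasoning poset

  between⇒a∧w≤e : ∀ {a b c e w} → b ≤ c → c ≤ e → ¬ b ≤ a → a ∨ b < a ∨ c →
    (a ∨ c) ∧ e ≤ w → w < a ∨ c → a ∧ w ≤ e
  between⇒a∧w≤e {a} {b} {c} {e} {w} b≤c c≤e b≰a a∨b<a∨c [a∨c]∧e≤w w<a∨c =
    case W ([a∨b]∧[a∧w∨c∧w]≤a∧w∨[a∨b]∧c {a} {b} {e} {w} (≤-trans b≤c c≤e)) of λ where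
      (inj₁ a∨b≤rhs) → begin-contradiction
        a ∨ c                  ≤⟨ ∨-least (≤-trans (x≤x∨y a b) (≤-trans a∨b≤rhs rhs≤w)) c≤w ⟩
        w                      <⟨ w<a∨c ⟩
        a ∨ c                  ∎
      (inj₂ (inj₁ a∧w∨e∧w≤rhs)) → begin-contradiction
        a ∨ c                  ≤⟨ ∨-monotonic ≤-refl (∧-greatest c≤e c≤w) ⟩
        a ∨ e ∧ w              ≤⟨ ∨-monotonic ≤-refl (≤-trans (y≤x∨y (a ∧ w) (e ∧ w)) a∧w∨e∧w≤rhs) ⟩
        a ∨ a ∧ w ∨ (a ∨ b) ∧ e  ≤⟨ ∨-least (x≤x∨y a b) rhs≤a∨b ⟩
        a ∨ b                  <⟨ a∨b<a∨c ⟩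
        a ∨ c                  ∎
      (inj₂ (inj₂ (inj₁ lhs≤a∧w))) → contradiction (begin
        b                              ≤⟨ ∧-greatest (y≤x∨y a b) (≤-trans b≤e∧w (y≤x∨y (a ∧ w) (e ∧ w))) ⟩
        (a ∨ b) ∧ (a ∧ w ∨ e ∧ w)      ≤⟨ lhs≤a∧w ⟩
        a ∧ w                          ≤⟨ x∧y≤x a w ⟩
        a                              ∎) b≰a
      (inj₂ (inj₂ (inj₂ lhs≤[a∨b]∧e))) → begin
        a ∧ w                          ≤⟨ ∧-greatest (≤-trans (x∧y≤x a w) (x≤x∨y a b)) (x≤x∨y (a ∧ w) (e ∧ w)) ⟩
        (a ∨ b) ∧ (a ∧ w ∨ e ∧ w)      ≤⟨ lhs≤[a∨b]∧e ⟩
        (a ∨ b) ∧ e                    ≤⟨ x∧y≤y (a ∨ b) e ⟩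
        e                              ∎
    where
    c≤w : c ≤ w
    c≤w = ≤-trans (∧-greatest (y≤x∨y a c) c≤e) [a∨c]∧e≤w
    b≤e∧w : b ≤ e ∧ w
    b≤e∧w = ∧-greatest (≤-trans b≤c c≤e) (≤-trans b≤c c≤w)
    rhs≤w : a ∧ w ∨ (a ∨ b) ∧ e ≤ w
    rhs≤w = ∨-least (x∧y≤y a w)
      (≤-trans (∧-greatest (≤-trans (x∧y≤x (a ∨ b) e) (∨-monotonic ≤-refl b≤c)) (x∧y≤y (a ∨ b) e)) [a∨c]∧e≤w)
    rhs≤a∨b : a ∧ w ∨ (a ∨ b) ∧ e ≤ a ∨ b
    rhs≤a∨b = ∨-least (≤-trans (x∧y≤x a w) (x≤x∨y a b)) (x∧y≤x (a ∨ b) e)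

  between⇒a∧w≰e : ∀ {a c d e w} → c ≤ d → d ≤ e → ¬ a ≤ e → a ∨ c < a ∨ d → a ∨ d < a ∨ e →
    (a ∨ c) ∧ e < w → w < a ∨ c → ¬ a ∧ w ≤ e
  between⇒a∧w≰e {a} {c} {d} {e} {w} c≤d d≤e a≰e a∨c<a∨d a∨d<a∨e [a∨c]∧e<w w<a∨c a∧w≤e =
    case W ([a∨b]∧[c∨w]≤w∨[a∨b]∧c {a} {d} {e} {w} d≤e a∧w≤e) of λ where
      (inj₁ a∨d≤rhs) →
        a≰e ([a∨d]≤w∨[a∨d]∧c⇒a≤c {a} {c} {e} {d} {w} (proj₁ [a∨c]∧e<w) a∧w≤e a∨d≤rhs)
      (inj₂ (inj₁ e∨w≤rhs)) → begin-contradiction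
        a ∨ e                ≤⟨ ∨-monotonic ≤-refl (≤-trans (x≤x∨y e w) e∨w≤rhs) ⟩
        a ∨ w ∨ (a ∨ d) ∧ e  ≤⟨ ∨-least (x≤x∨y a d) (∨-least w≤a∨d (x∧y≤x (a ∨ d) e)) ⟩
        a ∨ d                <⟨ a∨d<a∨e ⟩
        a ∨ e                ∎
      (inj₂ (inj₂ (inj₁ lhs≤w))) → begin-contradiction
        a ∨ d                ≤⟨ ∨-monotonic ≤-refl (∧-greatest (y≤x∨y a d) (≤-trans d≤e (x≤x∨y e w))) ⟩
        a ∨ (a ∨ d) ∧ (e ∨ w)  ≤⟨ ∨-monotonic ≤-refl lhs≤w ⟩
        a ∨ w                ≤⟨ ∨-least (x≤x∨y a c) (proj₁ w<a∨c) ⟩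
        a ∨ c                <⟨ a∨c<a∨d ⟩
        a ∨ d                ∎
      (inj₂ (inj₂ (inj₂ lhs≤[a∨d]∧e))) → begin-contradiction
        w                    ≤⟨ ∧-greatest (proj₁ w<a∨c) (≤-trans w≤lhs (≤-trans lhs≤[a∨d]∧e (x∧y≤y (a ∨ d) e))) ⟩
        (a ∨ c) ∧ e          <⟨ [a∨c]∧e<w ⟩
        w                    ∎
    where
    w≤a∨d : w ≤ a ∨ d
    w≤a∨d = ≤-trans (proj₁ w<a∨c) (∨-monotonic ≤-refl c≤d)
    w≤lhs : w ≤ (a ∨ d) ∧ (e ∨ w)
    w≤lhs = ∧-greatest w≤a∨d (y≤x∨y e w)

  [a∨c]∧e⋖a∨c : ∀ {a b c d e} → b ≤ c → c ≤ d → d ≤ e → ¬ b ≤ a → ¬ a ≤ e →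
    a ∨ b < a ∨ c → a ∨ c < a ∨ d → a ∨ d < a ∨ e → CoveredBy L ((a ∨ c) ∧ e) (a ∨ c)
  [a∨c]∧e⋖a∨c {a} {b} {c} {d} {e} b≤c c≤d d≤e b≰a a≰e a∨b<a∨c a∨c<a∨d a∨d<a∨e =
    ≤∧≉⇒< (x∧y≤x (a ∨ c) e) [a∨c]∧e≉a∨c , no-element-between
    where
    [a∨c]∧e≉a∨c : ¬ (a ∨ c) ∧ e ≈ a ∨ c
    [a∨c]∧e≉a∨c [a∨c]∧e≈a∨c = a≰e (begin
      a            ≤⟨ x≤x∨y a c ⟩
      a ∨ c        ≈⟨ [a∨c]∧e≈a∨c ⟨
      (a ∨ c) ∧ e  ≤⟨ x∧y≤y (a ∨ c) e ⟩
      e            ∎)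
    no-element-between : ∀ w → ¬ ((a ∨ c) ∧ e < w × w < a ∨ c)
    no-element-between w ([a∨c]∧e<w , w<a∨c) =
      between⇒a∧w≰e c≤d d≤e a≰e a∨c<a∨d a∨d<a∨e [a∨c]∧e<w w<a∨c
        (between⇒a∧w≤e b≤c (≤-trans c≤d d≤e) b≰a a∨b<a∨c (proj₁ [a∨c]∧e<w) w<a∨c)

theorem5p10 : ∀ {c ℓ x : Level} (L : Lattice c ℓ) (X : Set x) →
    EmbedsInFreeLattice L X →
    InVarietyN5 L →
    let open Lattice L in
    ∀ (a b₁ b₂ b₃ b₄ b₅ : Carrier) →
    _∥L_ L a b₁ → _∥L_ L a b₂ → _∥L_ L a b₃ → _∥L_ L a b₄ → _∥L_ L a b₅ →
    _<L_ L b₁ b₂ → _<L_ L b₂ b₃ → _<L_ L b₃ b₄ → _<L_ L b₄ b₅ →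
    _<L_ L (a ∨ b₁) (a ∨ b₂) → _<L_ L (a ∨ b₂) (a ∨ b₃) →
    _<L_ L (a ∨ b₃) (a ∨ b₄) → _<L_ L (a ∨ b₄) (a ∨ b₅) →
    ¬ (((a ∨ b₄) ∧ b₅) ≈ b₄) →
    CoveredBy L ((a ∨ b₃) ∧ b₅) (a ∨ b₃)
theorem5p10 L X E V a b₁ b₂ b₃ b₄ b₅ (_ , b₁≰a) _ _ _ (a≰b₅ , _)
  (b₁≤b₂ , _) (b₂≤b₃ , _) (b₃≤b₄ , _) (b₄≤b₅ , _)
  (a∨b₁≤a∨b₂ , _) a∨b₂<a∨b₃ a∨b₃<a∨b₄ a∨b₄<a∨b₅ _ =
  [a∨c]∧e⋖a∨c (≤-trans b₁≤b₂ b₂≤b₃) b₃≤b₄ b₄≤b₅ b₁≰a a≰b₅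
    a∨b₁<a∨b₃ a∨b₃<a∨b₄ a∨b₄<a∨b₅
  where
  open LatticeOrder L
  open Covering L V (embedding⇒whitman L X E)
  a∨b₁<a∨b₃ : a ∨ b₁ < a ∨ b₃
  a∨b₁<a∨b₃ = begin-strict a ∨ b₁ ≤⟨ a∨b₁≤a∨b₂ ⟩ a ∨ b₂ <⟨ a∨b₂<a∨b₃ ⟩ a ∨ b₃ ∎
    where open ≤-Reasoning poset
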